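{- Let $G = (V = L \cup R, E)$ be a bipartite graph with $|L|, |R| \le n$, let $\varepsilon \in (0,1)$, and let $A \subseteq L$, $B \subseteq R$. Let $G^+$ be the graph obtained from $G$ by adding, for each $a \in L \setminus A$, a new vertex $a'$ and the edge $(a,a')$, and for each $b \in R \setminus B$, a new vertex $b'$ and the edge $(b',b)$, where all the new vertices are distinct. Let $M$ be a matching of $G^+$ with $|M| \ge (1-\varepsilon)\mu(G^+)$. Then the set $M[A,B]$ of edges of $M$ with both endpoints in $A \cup B$ is a matching of $G[A,B]$ with $|M[A,B]| \ge \mu(G[A,B]) - 2\varepsilon n$.
   Context: $\mu(H)$ denotes the maximum matching size of a graph $H$. For $A \subseteq L$, $B \subseteq R$, $G[A,B]$ is the graph with vertex set $A \cup B$ and edges $\{(a,b) \in E : a \in A, b \in B\}$.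
   Formalization: The parameter ε ranges only over the rational numbers in the open interval (0,1). -}

module Defs where

open import Data.Nat using (ℕ; _≤_)
open import Data.Fin using (Fin)
open import Data.Fin.Subset using (Subset; Side; inside; outside)
open import Data.Vec using (lookup)
open import Data.List using (List; []; _∷_; map; length)
open import Data.List.Relation.Unary.All using (All)
open import Data.List.Relation.Unary.Unique.Propositional using (Unique)
open import Data.Product using (Σ; _×_; _,_; proj₁; proj₂)
open import Data.Sum using (_⊎_; inj₁; inj₂)
open import Data.Empty using (⊥)
open import Data.Integer using (+_)
open import Data.Rational using (ℚ; _/_)
open import Relation.Binary.PropositionalEquality using (_≡_; refl)

record BipGraph : Set₁ where
  field
    Left  : Set
    Right : Set
    Edge  : Left → Right → Set
open BipGraph public

-- A matching: a list of edges (each an element of E), no two sharing an endpoint.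
-- Uniqueness of left endpoints / right endpoints also forces the edges to be distinct.
record IsMatching (H : BipGraph) (M : List (Left H × Right H)) : Set where
  field
    edges      : All (λ e → Edge H (proj₁ e) (proj₂ e)) M
    leftDisj   : Unique (map proj₁ M)
    rightDisj  : Unique (map proj₂ M)

record IsMaxMatchingSize (H : BipGraph) (k : ℕ) : Set where
  field
    attained : Σ (List (Left H × Right H)) (λ M → IsMatching H M × length M ≡ k)
    bound    : (M : List (Left H × Right H)) → IsMatching H M → length M ≤ k

Graph : ℕ → ℕ → Set₁
Graph l r = Fin l → Fin r → Set

toBip : ∀ {l r} → Graph l r → BipGraph
toBip {l} {r} E = record { Left = Fin l ; Right = Fin r ; Edge = E }

_∈ₛ_ : ∀ {k} → Fin k → Subset k → Set
x ∈ₛ S = lookup S x ≡ inside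

_∉ₛ_ : ∀ {k} → Fin k → Subset k → Set
x ∉ₛ S = lookup S x ≡ outside

-- G⁺: left side L ⊎ {b' : b ∈ R ∖ B}, right side R ⊎ {a' : a ∈ L ∖ A}.
data EdgePlus {l r} (E : Graph l r) (A : Subset l) (B : Subset r) :
     Fin l ⊎ Σ (Fin r) (λ b → b ∉ₛ B) → Fin r ⊎ Σ (Fin l) (λ a → a ∉ₛ A) → Set where
  old    : ∀ {a b} → E a b → EdgePlus E A B (inj₁ a) (inj₁ b)
  pendL  : ∀ a (p : a ∉ₛ A) → EdgePlus E A B (inj₁ a) (inj₂ (a , p))
  pendR  : ∀ b (p : b ∉ₛ B) → EdgePlus E A B (inj₂ (b , p)) (inj₁ b)

GPlus : ∀ {l r} → Graph l r → Subset l → Subset r → BipGraph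
GPlus {l} {r} E A B = record
  { Left  = Fin l ⊎ Σ (Fin r) (λ b → b ∉ₛ B)
  ; Right = Fin r ⊎ Σ (Fin l) (λ a → a ∉ₛ A)
  ; Edge  = EdgePlus E A B }

Induced : ∀ {l r} → Graph l r → Subset l → Subset r → BipGraph
Induced {l} {r} E A B = record
  { Left  = Σ (Fin l) (λ a → a ∈ₛ A)
  ; Right = Σ (Fin r) (λ b → b ∈ₛ B)
  ; Edge  = λ a b → E (proj₁ a) (proj₁ b) }

memb : ∀ {k} (S : Subset k) (x : Fin k) → (x ∈ₛ S) ⊎ (x ∉ₛ S)
memb S x = go (lookup S x) refl
  where
  go : (s : Side) → lookup S x ≡ s → (x ∈ₛ S) ⊎ (x ∉ₛ S)
  go inside  eq = inj₁ eq
  go outside eq = inj₂ eq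

-- M[A,B]: the edges of M with both endpoints in A ∪ B (i.e. original edges a ∈ A, b ∈ B)
restrict : ∀ {l r} (E : Graph l r) (A : Subset l) (B : Subset r) →
           List (Left (GPlus E A B) × Right (GPlus E A B)) →
           List (Left (Induced E A B) × Right (Induced E A B))
restrict E A B [] = []
restrict E A B ((inj₁ a , inj₁ b) ∷ M) with memb A a | memb B b
... | inj₁ pa | inj₁ pb = ((a , pa) , (b , pb)) ∷ restrict E A B M
... | _       | _       = restrict E A B M
restrict E A B ((inj₁ _ , inj₂ _) ∷ M) = restrict E A B M
restrict E A B ((inj₂ _ , _) ∷ M) = restrict E A B M

ℕ→ℚ : ℕ → ℚ
ℕ→ℚ k = (+ k) / 1

{-# OPTIONS --safe #-}
module Submission where

-- Write c = |L ∖ A| + |R ∖ B| for the number of pendant edges of G⁺. An edge of G⁺ that does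
-- not lie in G[A,B] has its left endpoint in L ∖ A or its right endpoint in R ∖ B, and M
-- covers each such vertex at most once, so |M| ≤ |M[A,B]| + c. A maximum matching of G[A,B]
-- together with all pendant edges is a matching of G⁺, so μ(G[A,B]) + c ≤ μ(G⁺). Finally
-- μ(G⁺) ≤ |L| + |R| ≤ 2n. Hence μ(G[A,B]) − |M[A,B]| ≤ μ(G⁺) − |M| ≤ ε μ(G⁺) ≤ 2εn.

open import Defs
open import Data.Nat using (ℕ; _≤_)
open import Data.Fin.Subset using (Subset)
open import Data.List using (List; length)
open import Data.Product using (_×_; _,_)
open import Data.Rational using (ℚ; 0ℚ; 1ℚ; _<_; _*_; _-_) renaming (_≤_ to _≤ℚ_)

open import Axiom.UniquenessOfIdentityProofs.WithK using (uip)
import Data.Integer as ℤ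
import Data.Integer.Properties as ℤ
open import Data.Fin using (Fin; zero; suc; join; splitAt)
open import Data.Fin.Properties using (injective⇒≤; splitAt-join)
open import Data.Fin.Subset using (Side)
open import Data.List using ([]; _∷_; _++_; map; mapMaybe; allFin; lookup)
open import Data.List.Properties using (map-∘; map-++; length-map; length-++; length-tabulate)
open import Data.List.Membership.Propositional using (_∈_)
open import Data.List.Membership.Propositional.Properties using (∈-lookup; ∈-allFin; ∈-map⁻)
open import Data.List.Relation.Binary.Disjoint.Propositional using (Disjoint)
open import Data.List.Relation.Binary.Subset.Propositional using (_⊆_)
open import Data.List.Relation.Binary.Sublist.Propositional using ([]; _∷_; _∷ʳ_) renaming (_⊆_ to _⊑_)
import Data.List.Relation.Binary.Sublist.Propositional.Properties as Sublist
open import Data.List.Relation.Unary.All as All using (All; []; _∷_)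
import Data.List.Relation.Unary.All.Properties as All
open import Data.List.Relation.Unary.AllPairs using ([]; _∷_)
import Data.List.Relation.Unary.Any as Any
import Data.List.Relation.Unary.Any.Properties as Any
open import Data.List.Relation.Unary.Unique.Propositional using (Unique)
import Data.List.Relation.Unary.Unique.Propositional.Properties as Unique
open import Data.Maybe using (Maybe; just; nothing)
import Data.Maybe.Relation.Unary.Any as Maybe
open import Data.Nat using (suc; _+_; z≤n; s≤s) renaming (_<_ to _<ℕ_)
import Data.Nat.Properties as ℕ
import Data.Product as Product
open import Data.Product using (Σ; proj₁; proj₂)
open import Data.Rational using (-_; toℚᵘ; NonNegative; nonNegative) renaming (_+_ to _+ℚ_)
open import Data.Rational.Properties
  using ( toℚᵘ-fromℚᵘ; toℚᵘ-cancel-≤; toℚᵘ-injective; toℚᵘ-homo-+; <⇒≤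
        ; +-monoˡ-≤; +-monoʳ-≤; neg-antimono-≤; *-monoˡ-≤-nonNeg; module ≤-Reasoning)
open import Data.Rational.Solver using (module +-*-Solver)
open import Data.Rational.Unnormalised using (mkℚᵘ; *≡*; *≤*) renaming (_≃_ to _≃ᵘ_; _+_ to _+ᵘ_)
import Data.Rational.Unnormalised.Properties as ℚᵘ
import Data.Sum as Sum
open import Data.Sum using (_⊎_; inj₁; inj₂; [_,_]′)
open import Data.Sum.Properties using (inj₁-injective; inj₂-injective)
import Data.Vec as Vec
open import Function using (_∘_; const; Injective)
open import Relation.Binary.PropositionalEquality
  using (_≡_; _≢_; refl; sym; trans; cong; cong₂; subst; subst₂; module ≡-Reasoning)
open import Relation.Nullary using (contradiction)

private variable
  V W : Set
  x : V
  y : W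
  xs ys : List V

Unique⇒lookup-injective : Unique xs → Injective _≡_ _≡_ (lookup xs)
Unique⇒lookup-injective (_    ∷ _) {zero}  {zero}  _  = refl
Unique⇒lookup-injective (x∉xs ∷ u) {zero}  {suc j} eq = contradiction eq (All.lookup x∉xs (∈-lookup j))
Unique⇒lookup-injective (x∉xs ∷ u) {suc i} {zero}  eq = contradiction (sym eq) (All.lookup x∉xs (∈-lookup i))
Unique⇒lookup-injective (x∉xs ∷ u) {suc i} {suc j} eq = cong suc (Unique⇒lookup-injective u eq)

Unique⇒length≤ : Unique xs → xs ⊆ ys → length xs ≤ length ys
Unique⇒length≤ {xs = xs} {ys = ys} u xs⊆ys = injective⇒≤ position-injective
  where
  position : Fin (length xs) → Fin (length ys)
  position i = Any.index (xs⊆ys (∈-lookup i))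

  position-injective : Injective _≡_ _≡_ position
  position-injective {i} {j} eq = Unique⇒lookup-injective u (begin
    lookup xs i            ≡⟨ Any.lookup-index (xs⊆ys (∈-lookup i)) ⟩
    lookup ys (position i) ≡⟨ cong (lookup ys) eq ⟩
    lookup ys (position j) ≡⟨ Any.lookup-index (xs⊆ys (∈-lookup j)) ⟨
    lookup xs j            ∎)
    where open ≡-Reasoning

Unique-resp-⊑ : xs ⊑ ys → Unique ys → Unique xs
Unique-resp-⊑ []         []          = []
Unique-resp-⊑ (_ ∷ʳ τ)   (_ ∷ u)     = Unique-resp-⊑ τ u
Unique-resp-⊑ (refl ∷ τ) (y∉ys ∷ u) = Sublist.All-resp-⊆ τ y∉ys ∷ Unique-resp-⊑ τ u

module _ {f : V → Maybe W} {g : W → V} (g-inverse : ∀ {x y} → f x ≡ just y → g y ≡ x) where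

  map-mapMaybe-⊑ : ∀ xs → map g (mapMaybe f xs) ⊑ xs
  map-mapMaybe-⊑ []       = []
  map-mapMaybe-⊑ (x ∷ xs) with f x in fx≡
  ... | nothing = x ∷ʳ map-mapMaybe-⊑ xs
  ... | just y  = g-inverse fx≡ ∷ map-mapMaybe-⊑ xs

  Unique-mapMaybe : Unique xs → Unique (mapMaybe f xs)
  Unique-mapMaybe {xs = xs} u = Unique.map⁻ (Unique-resp-⊑ (map-mapMaybe-⊑ xs) u)

∈-mapMaybe⁺ : {f : V → Maybe W} → x ∈ xs → f x ≡ just y → y ∈ mapMaybe f xs
∈-mapMaybe⁺ {xs = xs} {f = f} x∈xs fx≡y =
  Any.mapMaybe⁺ f xs (Any.map⁺ (Any.map (λ { refl → subst (Maybe.Any _) (sym fx≡y) (Maybe.just refl) })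
                                         x∈xs))

Apart : V × W → V × W → Set
Apart (u , v) (u′ , v′) = u ≢ u′ × v ≢ v′

module _ {H : BipGraph} where

  open IsMatching

  IsMatching-⊑ : ∀ {M M′} → M′ ⊑ M → IsMatching H M → IsMatching H M′
  IsMatching-⊑ τ m = record
    { edges     = Sublist.All-resp-⊆ τ (edges m)
    ; leftDisj  = Unique-resp-⊑ (Sublist.map⁺ proj₁ τ) (leftDisj m)
    ; rightDisj = Unique-resp-⊑ (Sublist.map⁺ proj₂ τ) (rightDisj m)
    }

  IsMatching-++ : ∀ {M₁ M₂} → IsMatching H M₁ → IsMatching H M₂ →
                  All (λ e → All (Apart e) M₂) M₁ → IsMatching H (M₁ ++ M₂)
  IsMatching-++ {M₁} {M₂} m₁ m₂ apart = record
    { edges     = All.++⁺ (edges m₁) (edges m₂)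
    ; leftDisj  = subst Unique (sym (map-++ proj₁ M₁ M₂))
                    (Unique.++⁺ (leftDisj m₁) (leftDisj m₂) (disjoint proj₁ proj₁))
    ; rightDisj = subst Unique (sym (map-++ proj₂ M₁ M₂))
                    (Unique.++⁺ (rightDisj m₁) (rightDisj m₂) (disjoint proj₂ proj₂))
    }
    where
    disjoint : ∀ {T : Set} (end : Left H × Right H → T) → (∀ {e e′} → Apart e e′ → end e ≢ end e′) →
               Disjoint (map end M₁) (map end M₂)
    disjoint end apart⇒≢ (w∈M₁ , w∈M₂) with ∈-map⁻ end w∈M₁ | ∈-map⁻ end w∈M₂
    ... | e₁ , e₁∈M₁ , refl | e₂ , e₂∈M₂ , w≡ = apart⇒≢ (All.lookup (All.lookup apart e₁∈M₁) e₂∈M₂) w≡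

  IsMatching-map-injective : {e : V → Left H × Right H} →
                             (∀ x → Edge H (proj₁ (e x)) (proj₂ (e x))) →
                             Injective _≡_ _≡_ (proj₁ ∘ e) → Injective _≡_ _≡_ (proj₂ ∘ e) →
                             Unique xs → IsMatching H (map e xs)
  IsMatching-map-injective {xs = xs} edge injˡ injʳ u = record
    { edges     = All.map⁺ (All.universal edge xs)
    ; leftDisj  = subst Unique (map-∘ xs) (Unique.map⁺ injˡ u)
    ; rightDisj = subst Unique (map-∘ xs) (Unique.map⁺ injʳ u)
    }

  IsMatching⇒length≤ : ∀ {k M} (f : Left H → Fin k) → Injective _≡_ _≡_ f → IsMatching H M → length M ≤ k
  IsMatching⇒length≤ {k} {M} f f-injective m = begin
    length M                     ≡⟨ trans (sym (length-map proj₁ M)) (sym (length-map f (map proj₁ M))) ⟩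
    length (map f (map proj₁ M)) ≤⟨ Unique⇒length≤ (Unique.map⁺ f-injective (leftDisj m)) (λ _ → ∈-allFin _) ⟩
    length (allFin k)            ≡⟨ length-tabulate _ ⟩
    k                            ∎
    where open ℕ.≤-Reasoning

module _ {H H′ : BipGraph} {f : Left H → Left H′} {g : Right H → Right H′} where

  open IsMatching

  map-proj₁-map : ∀ M → map proj₁ (map (Product.map f g) M) ≡ map f (map proj₁ M)
  map-proj₁-map M = trans (sym (map-∘ M)) (map-∘ M)

  map-proj₂-map : ∀ M → map proj₂ (map (Product.map f g) M) ≡ map g (map proj₂ M)
  map-proj₂-map M = trans (sym (map-∘ M)) (map-∘ M)

  IsMatching-map⁺ : ∀ {M} → Injective _≡_ _≡_ f → Injective _≡_ _≡_ g →
                    (∀ {u v} → Edge H u v → Edge H′ (f u) (g v)) →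
                    IsMatching H M → IsMatching H′ (map (Product.map f g) M)
  IsMatching-map⁺ {M} f-injective g-injective edge m = record
    { edges     = All.map⁺ (All.map edge (edges m))
    ; leftDisj  = subst Unique (sym (map-proj₁-map M)) (Unique.map⁺ f-injective (leftDisj m))
    ; rightDisj = subst Unique (sym (map-proj₂-map M)) (Unique.map⁺ g-injective (rightDisj m))
    }

  IsMatching-map⁻ : ∀ {M} → (∀ {u v} → Edge H′ (f u) (g v) → Edge H u v) →
                    IsMatching H′ (map (Product.map f g) M) → IsMatching H M
  IsMatching-map⁻ {M} edge m = record
    { edges     = All.map edge (All.map⁻ (edges m))
    ; leftDisj  = Unique.map⁻ (subst Unique (map-proj₁-map M) (leftDisj m))
    ; rightDisj = Unique.map⁻ (subst Unique (map-proj₂-map M) (rightDisj m))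
    }

module _ {k : ℕ} where

  Outside : Subset k → Set
  Outside S = Σ (Fin k) (_∉ₛ S)

  proj₁-injective : ∀ {S : Subset k} {s : Side} → Injective _≡_ _≡_ (proj₁ {B = λ x → Vec.lookup S x ≡ s})
  proj₁-injective {x = x , p} {y = .x , q} refl = cong (x ,_) (uip p q)

  ∈∉⇒≢ : ∀ {S : Subset k} {x y} → x ∈ₛ S → y ∉ₛ S → x ≢ y
  ∈∉⇒≢ x∈S y∉S refl with trans (sym x∈S) y∉S
  ... | ()

  outside? : (S : Subset k) → Fin k → Maybe (Outside S)
  outside? S x with memb S x
  ... | inj₁ _   = nothing
  ... | inj₂ x∉S = just (x , x∉S)

  outside?-inverse : ∀ {S x y} → outside? S x ≡ just y → proj₁ y ≡ x
  outside?-inverse {S} {x} eq with memb S x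
  outside?-inverse refl | inj₂ _ = refl

  outside?-complete : ∀ {S x} (x∉S : x ∉ₛ S) → outside? S x ≡ just (x , x∉S)
  outside?-complete {S} {x} x∉S with memb S x
  ... | inj₁ x∈S  = contradiction refl (∈∉⇒≢ {S = S} x∈S x∉S)
  ... | inj₂ x∉S′ = cong (λ p → just (x , p)) (uip x∉S′ x∉S)

  outside : (S : Subset k) → List (Outside S)
  outside S = mapMaybe (outside? S) (allFin k)

  outside-unique : ∀ S → Unique (outside S)
  outside-unique S = Unique-mapMaybe outside?-inverse (Unique.allFin⁺ k)

  ∈-outside : ∀ {S} (x : Outside S) → x ∈ outside S
  ∈-outside (x , x∉S) = ∈-mapMaybe⁺ (∈-allFin x) (outside?-complete x∉S)

  outsideVertex? : (S : Subset k) → Fin k ⊎ W → Maybe (Outside S)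
  outsideVertex? S = [ outside? S , const nothing ]′

  outsideVertex?-inverse : ∀ {S} {v : Fin k ⊎ W} {x} → outsideVertex? S v ≡ just x → inj₁ (proj₁ x) ≡ v
  outsideVertex?-inverse {v = inj₁ a} eq = cong inj₁ (outside?-inverse eq)

  length-outsideVertices≤ : ∀ S {vs : List (Fin k ⊎ W)} → Unique vs →
                            length (mapMaybe (outsideVertex? S) vs) ≤ length (outside S)
  length-outsideVertices≤ S u =
    Unique⇒length≤ (Unique-mapMaybe (outsideVertex?-inverse {S = S}) u) (λ {x} _ → ∈-outside {S = S} x)

-- ℕ→ℚ k = + k / 1 is definitionally fromℚᵘ (mkℚᵘ (+ k) 0).
toℚᵘ-ℕ→ℚ : ∀ k → toℚᵘ (ℕ→ℚ k) ≃ᵘ mkℚᵘ (ℤ.+ k) 0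
toℚᵘ-ℕ→ℚ k = toℚᵘ-fromℚᵘ (mkℚᵘ (ℤ.+ k) 0)

ℕ→ℚ-mono-≤ : ∀ {m n} → m ≤ n → ℕ→ℚ m ≤ℚ ℕ→ℚ n
ℕ→ℚ-mono-≤ {m} {n} m≤n = toℚᵘ-cancel-≤
  (ℚᵘ.≤-respʳ-≃ (ℚᵘ.≃-sym (toℚᵘ-ℕ→ℚ n)) (ℚᵘ.≤-respˡ-≃ (ℚᵘ.≃-sym (toℚᵘ-ℕ→ℚ m))
    (*≤* (subst₂ ℤ._≤_ (sym (ℤ.*-identityʳ _)) (sym (ℤ.*-identityʳ _)) (ℤ.+≤+ m≤n)))))

ℕ→ℚ-homo-+ : ∀ m n → ℕ→ℚ (m + n) ≡ ℕ→ℚ m +ℚ ℕ→ℚ n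
ℕ→ℚ-homo-+ m n = toℚᵘ-injective (begin
  toℚᵘ (ℕ→ℚ (m + n))               ≈⟨ toℚᵘ-ℕ→ℚ (m + n) ⟩
  mkℚᵘ (ℤ.+ (m + n)) 0             ≈⟨ *≡* (cong (ℤ._* ℤ.+ 1) pos-+) ⟩
  mkℚᵘ (ℤ.+ m) 0 +ᵘ mkℚᵘ (ℤ.+ n) 0 ≈⟨ ℚᵘ.+-cong (toℚᵘ-ℕ→ℚ m) (toℚᵘ-ℕ→ℚ n) ⟨
  toℚᵘ (ℕ→ℚ m) +ᵘ toℚᵘ (ℕ→ℚ n)    ≈⟨ toℚᵘ-homo-+ (ℕ→ℚ m) (ℕ→ℚ n) ⟨
  toℚᵘ (ℕ→ℚ m +ℚ ℕ→ℚ n)           ∎)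
  where
  open ℚᵘ.≃-Reasoning
  pos-+ : ℤ.+ (m + n) ≡ ℤ.+ m ℤ.* ℤ.+ 1 ℤ.+ ℤ.+ n ℤ.* ℤ.+ 1
  pos-+ = trans (ℤ.pos-+ m n) (sym (cong₂ ℤ._+_ (ℤ.*-identityʳ (ℤ.+ m)) (ℤ.*-identityʳ (ℤ.+ n))))

approximation-loss : ∀ {ε} (k x m c u n : ℕ) → 0ℚ ≤ℚ ε → (1ℚ - ε) * ℕ→ℚ u ≤ℚ ℕ→ℚ m →
                     m ≤ x + c → k + c ≤ u → u ≤ n + n →
                     ℕ→ℚ k - ℕ→ℚ 2 * ε * ℕ→ℚ n ≤ℚ ℕ→ℚ x
approximation-loss {ε} k x m c u n 0≤ε approx m≤x+c k+c≤u u≤n+n = begin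
  K - ℕ→ℚ 2 * ε * N        ≡⟨ solve 3 (λ k ε n → k :- (con 1ℚ :+ con 1ℚ) :* ε :* n := k :- ε :* (n :+ n))
                                      refl K ε N ⟩
  K - ε * (N +ℚ N)         ≤⟨ +-monoʳ-≤ K (neg-antimono-≤ (*-monoˡ-≤-nonNeg ε U≤N+N)) ⟩
  K - ε * U                ≡⟨ solve 4 (λ k ε u c → k :- ε :* u := (k :+ c) :- (c :+ ε :* u)) refl K ε U C ⟩
  (K +ℚ C) - (C +ℚ ε * U)  ≤⟨ +-monoˡ-≤ (- (C +ℚ ε * U)) K+C≤U ⟩
  U - (C +ℚ ε * U)         ≡⟨ solve 3 (λ ε u c → u :- (c :+ ε :* u) := (con 1ℚ :- ε) :* u :- c) refl ε U C ⟩
  (1ℚ - ε) * U - C         ≤⟨ +-monoˡ-≤ (- C) approx ⟩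
  M - C                    ≤⟨ +-monoˡ-≤ (- C) M≤X+C ⟩
  (X +ℚ C) - C             ≡⟨ solve 2 (λ x c → (x :+ c) :- c := x) refl X C ⟩
  X                        ∎
  where
  open ≤-Reasoning
  open +-*-Solver

  instance
    ε-nonNegative : NonNegative ε
    ε-nonNegative = nonNegative 0≤ε

  K X M C U N : ℚ
  K = ℕ→ℚ k; X = ℕ→ℚ x; M = ℕ→ℚ m; C = ℕ→ℚ c; U = ℕ→ℚ u; N = ℕ→ℚ n

  U≤N+N : U ≤ℚ N +ℚ N
  U≤N+N = subst (U ≤ℚ_) (ℕ→ℚ-homo-+ n n) (ℕ→ℚ-mono-≤ u≤n+n)

  K+C≤U : K +ℚ C ≤ℚ U
  K+C≤U = subst (_≤ℚ U) (ℕ→ℚ-homo-+ k c) (ℕ→ℚ-mono-≤ k+c≤u)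

  M≤X+C : M ≤ℚ X +ℚ C
  M≤X+C = subst (M ≤ℚ_) (ℕ→ℚ-homo-+ x c) (ℕ→ℚ-mono-≤ m≤x+c)

module PendantExtension {l r : ℕ} (E : Graph l r) (A : Subset l) (B : Subset r) where

  open IsMatching

  G⁺ G[A,B] : BipGraph
  G⁺ = GPlus E A B
  G[A,B] = Induced E A B

  L⁺ R⁺ : Set
  L⁺ = Left G⁺
  R⁺ = Right G⁺

  ιˡ : Left G[A,B] → L⁺
  ιˡ = inj₁ ∘ proj₁

  ιʳ : Right G[A,B] → R⁺
  ιʳ = inj₁ ∘ proj₁

  embed : Left G[A,B] × Right G[A,B] → L⁺ × R⁺
  embed = Product.map ιˡ ιʳ

  restrict-⊑ : ∀ M → map embed (restrict E A B M) ⊑ M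
  restrict-⊑ [] = []
  restrict-⊑ ((inj₁ a , inj₁ b) ∷ M) with memb A a | memb B b
  ... | inj₁ _ | inj₁ _ = refl ∷ restrict-⊑ M
  ... | inj₁ _ | inj₂ _ = _ ∷ʳ restrict-⊑ M
  ... | inj₂ _ | _      = _ ∷ʳ restrict-⊑ M
  restrict-⊑ ((inj₁ _ , inj₂ _) ∷ M) = _ ∷ʳ restrict-⊑ M
  restrict-⊑ ((inj₂ _ , _) ∷ M)      = _ ∷ʳ restrict-⊑ M

  old⁻¹ : ∀ {a b} → EdgePlus E A B (inj₁ a) (inj₁ b) → E a b
  old⁻¹ (old e) = e

  restrict-IsMatching : ∀ {M} → IsMatching G⁺ M → IsMatching G[A,B] (restrict E A B M)
  restrict-IsMatching {M} m = IsMatching-map⁻ old⁻¹ (IsMatching-⊑ (restrict-⊑ M) m)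

  outerLefts : List (L⁺ × R⁺) → List (Outside A)
  outerLefts M = mapMaybe (outsideVertex? A) (map proj₁ M)

  outerRights : List (L⁺ × R⁺) → List (Outside B)
  outerRights M = mapMaybe (outsideVertex? B) (map proj₂ M)

  private
    grow : ∀ M {t} →
           length M ≤ length (restrict E A B M) + (length (outerLefts M) + length (outerRights M)) →
           length (outerLefts M) + length (outerRights M) <ℕ t →
           suc (length M) ≤ length (restrict E A B M) + t
    grow M ih outer< = ℕ.≤-<-trans ih (ℕ.+-monoʳ-< (length (restrict E A B M)) outer<)

    +-suc-< : ∀ y z → y + z <ℕ y + suc z
    +-suc-< y z = ℕ.≤-reflexive (sym (ℕ.+-suc y z))

  length≤restrict+outer : ∀ M → All (λ e → Edge G⁺ (proj₁ e) (proj₂ e)) M →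
    length M ≤ length (restrict E A B M) + (length (outerLefts M) + length (outerRights M))
  length≤restrict+outer [] [] = z≤n
  length≤restrict+outer ((inj₁ a , inj₁ b) ∷ M) (old _ ∷ es) with memb A a | memb B b
  ... | inj₁ _ | inj₁ _ = s≤s (length≤restrict+outer M es)
  ... | inj₁ _ | inj₂ _ = grow M (length≤restrict+outer M es) (+-suc-< (length (outerLefts M)) _)
  ... | inj₂ _ | inj₁ _ = grow M (length≤restrict+outer M es) (ℕ.n<1+n _)
  ... | inj₂ _ | inj₂ _ = grow M (length≤restrict+outer M es)
                            (ℕ.m<n⇒m<1+n (+-suc-< (length (outerLefts M)) _))
  length≤restrict+outer ((inj₁ a , inj₂ _) ∷ M) (pendL _ a∉A ∷ es) with memb A a
  ... | inj₁ a∈A = contradiction refl (∈∉⇒≢ {S = A} a∈A a∉A)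
  ... | inj₂ _   = grow M (length≤restrict+outer M es) (ℕ.n<1+n _)
  length≤restrict+outer ((inj₂ _ , inj₁ b) ∷ M) (pendR _ b∉B ∷ es) with memb B b
  ... | inj₁ b∈B = contradiction refl (∈∉⇒≢ {S = B} b∈B b∉B)
  ... | inj₂ _   = grow M (length≤restrict+outer M es) (+-suc-< (length (outerLefts M)) _)

  #pendants : ℕ
  #pendants = length (outside A) + length (outside B)

  length≤restrict+#pendants : ∀ {M} → IsMatching G⁺ M → length M ≤ length (restrict E A B M) + #pendants
  length≤restrict+#pendants {M} m = ℕ.≤-trans (length≤restrict+outer M (edges m))
    (ℕ.+-monoʳ-≤ (length (restrict E A B M))
      (ℕ.+-mono-≤ (length-outsideVertices≤ A (leftDisj m)) (length-outsideVertices≤ B (rightDisj m))))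

  pendantˡ : Outside A → L⁺ × R⁺
  pendantˡ (a , a∉A) = inj₁ a , inj₂ (a , a∉A)

  pendantʳ : Outside B → L⁺ × R⁺
  pendantʳ (b , b∉B) = inj₂ (b , b∉B) , inj₁ b

  pendants : List (L⁺ × R⁺)
  pendants = map pendantˡ (outside A) ++ map pendantʳ (outside B)

  length-pendants : length pendants ≡ #pendants
  length-pendants = trans (length-++ (map pendantˡ (outside A)))
    (cong₂ _+_ (length-map pendantˡ (outside A)) (length-map pendantʳ (outside B)))

  pendants-IsMatching : IsMatching G⁺ pendants
  pendants-IsMatching = IsMatching-++
    (IsMatching-map-injective (λ (a , a∉A) → pendL a a∉A)
      (proj₁-injective {S = A} ∘ inj₁-injective) inj₂-injective (outside-unique A))
    (IsMatching-map-injective (λ (b , b∉B) → pendR b b∉B)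
      inj₂-injective (proj₁-injective {S = B} ∘ inj₁-injective) (outside-unique B))
    (All.map⁺ (All.universal (λ _ → All.map⁺ (All.universal (λ _ → (λ ()) , (λ ())) (outside B)))
                             (outside A)))

  embed-apart-pendants : ∀ e → All (Apart (embed e)) pendants
  embed-apart-pendants ((a , a∈A) , (b , b∈B)) = All.++⁺
    (All.map⁺ (All.universal (λ (a′ , a′∉A) → ∈∉⇒≢ {S = A} a∈A a′∉A ∘ inj₁-injective , (λ ())) (outside A)))
    (All.map⁺ (All.universal (λ (b′ , b′∉B) → (λ ()) , ∈∉⇒≢ {S = B} b∈B b′∉B ∘ inj₁-injective) (outside B)))

  extend-IsMatching : ∀ {N} → IsMatching G[A,B] N → IsMatching G⁺ (map embed N ++ pendants)
  extend-IsMatching {N} n = IsMatching-++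
    (IsMatching-map⁺ (proj₁-injective {S = A} ∘ inj₁-injective) (proj₁-injective {S = B} ∘ inj₁-injective)
                     old n)
    pendants-IsMatching
    (All.map⁺ (All.universal embed-apart-pendants N))

  length-extend : ∀ N → length (map embed N ++ pendants) ≡ length N + #pendants
  length-extend N = trans (length-++ (map embed N)) (cong₂ _+_ (length-map embed N) length-pendants)

  μ+#pendants≤μ⁺ : ∀ {μ μ⁺} → IsMaxMatchingSize G[A,B] μ → IsMaxMatchingSize G⁺ μ⁺ → μ + #pendants ≤ μ⁺
  μ+#pendants≤μ⁺ μ-max μ⁺-max with IsMaxMatchingSize.attained μ-max
  ... | N , n , refl =
    subst (_≤ _) (length-extend N) (IsMaxMatchingSize.bound μ⁺-max _ (extend-IsMatching n))

  flatten : L⁺ → Fin (l + r)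
  flatten = join l r ∘ Sum.map₂ proj₁

  flatten-injective : Injective _≡_ _≡_ flatten
  flatten-injective eq =
    map₂-proj₁-injective (trans (sym (splitAt-join l r _))
                                (trans (cong (splitAt l) eq) (splitAt-join l r _)))
    where
    map₂-proj₁-injective : Injective _≡_ _≡_ (Sum.map₂ {A = Fin l} (proj₁ {B = _∉ₛ B}))
    map₂-proj₁-injective {inj₁ a} {inj₁ .a} refl = refl
    map₂-proj₁-injective {inj₂ x} {inj₂ y} eq = cong inj₂ (proj₁-injective {S = B} (inj₂-injective eq))

  μ⁺≤l+r : ∀ {μ⁺} → IsMaxMatchingSize G⁺ μ⁺ → μ⁺ ≤ l + r
  μ⁺≤l+r μ⁺-max with IsMaxMatchingSize.attained μ⁺-max
  ... | M , m , refl = IsMatching⇒length≤ flatten flatten-injective m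

lemma1p12 : (n l r : ℕ) → l ≤ n → r ≤ n → (E : Graph l r) →
    (ε : ℚ) → 0ℚ < ε → ε < 1ℚ →
    (A : Subset l) (B : Subset r) →
    (μ⁺ μAB : ℕ) → IsMaxMatchingSize (GPlus E A B) μ⁺ →
    IsMaxMatchingSize (Induced E A B) μAB →
    (M : List (Left (GPlus E A B) × Right (GPlus E A B))) →
    IsMatching (GPlus E A B) M →
    (1ℚ - ε) * ℕ→ℚ μ⁺ ≤ℚ ℕ→ℚ (length M) →
    IsMatching (Induced E A B) (restrict E A B M)
      × (ℕ→ℚ μAB - ℕ→ℚ 2 * ε * ℕ→ℚ n ≤ℚ ℕ→ℚ (length (restrict E A B M)))
-- The bound holds for every ε ≥ 0.
lemma1p12 n l r l≤n r≤n E ε 0<ε _ A B μ⁺ μAB μ⁺-max μAB-max M M-matching M-approx =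
  restrict-IsMatching M-matching ,
  approximation-loss μAB (length (restrict E A B M)) (length M) #pendants μ⁺ n (<⇒≤ 0<ε) M-approx
    (length≤restrict+#pendants M-matching)
    (μ+#pendants≤μ⁺ μAB-max μ⁺-max)
    (ℕ.≤-trans (μ⁺≤l+r μ⁺-max) (ℕ.+-mono-≤ l≤n r≤n))
  where open PendantExtension E A B
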